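{- Let $s$ be a theory of $\mathbb{LUT}$ and $\phi$ a formula, and put $s+\phi=\{\psi\mid\phi\to\psi\in s\}$. Then (1) $s+\phi$ is a theory and $s\cup\{\phi\}\subseteq s+\phi$; (2) $s+\phi$ is consistent if and only if $\neg\phi\notin s$.
   Context: The language $\mathbf{LUT}$ over a countably infinite set $\mathbf{P}$ of propositional variables and a finite set $\mathbf{I}$ of agents is $\phi::= p\mid\neg\phi\mid(\phi\land\phi)\mid K_i\phi\mid[\phi]\phi\mid U_i\phi$; $\mathbf{EL}$ is the fragment without $[\cdot]$ and $U_i$. Admissible forms: $\eta(\sharp)::=\sharp\mid\phi\to\eta(\sharp)\mid K_i\eta(\sharp)\mid[\phi]\eta(\sharp)$; $\eta(\chi)$ denotes the result of replacing $\sharp$ by $\chi$. The proof system $\mathbb{LUT}$ has axioms: propositional tautologies; $K_i(\phi\to\psi)\to(K_i\phi\to K_i\psi)$; $[\chi](\phi\to\psi)\to([\chi]\phi\to[\chi]\psi)$; $K_i\phi\to\phi$; $[\psi]p\leftrightarrow(\psi\to p)$; $[\psi]\neg\phi\leftrightarrow(\psi\to\neg[\psi]\phi)$; $[\psi](\phi\land\chi)\leftrightarrow([\psi]\phi\land[\psi]\chi)$; $[\psi]K_i\phi\leftrightarrow(\psi\to K_i[\psi]\phi)$; $[\psi][\chi]\phi\leftrightarrow[\psi\land[\psi]\chi]\phi$; $U_i\phi\to\phi\land[\psi]\neg K_i\phi$ for each $\psi\in\mathbf{EL}$; rules: modus ponens (MP), $\phi/K_i\phi$, $\phi/[\chi]\phi$,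 and RU: from $\eta(\phi\land[\psi]\neg K_i\phi)$ for all $\psi\in\mathbf{EL}$ infer $\eta(U_i\phi)$, for any admissible form $\eta$. Let $\mathbf{Thm}$ be its set of theorems. A set of formulas $s$ is a theory if $\mathbf{Thm}\subseteq s$ and $s$ is closed under MP and under RU (for every admissible form $\eta$, formula $\phi$ and agent $i$: if $\eta(\phi\land[\psi]\neg K_i\phi)\in s$ for all $\psi\in\mathbf{EL}$, then $\eta(U_i\phi)\in s$). A theory is consistent if $\bot\notin s$. -}

module Defs where

open import Data.Nat using (ℕ)
open import Data.Fin using (Fin)
open import Data.Bool using (Bool; true; false; not; _∧_)
open import Data.Product using (_×_)
open import Relation.Binary.PropositionalEquality using (_≡_)
open import Relation.Nullary using (¬_)
open import Relation.Unary using (Pred)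
open import Level using (0ℓ)

-- Agents: the finite set I is Fin n.  Propositional variables: ℕ (countably infinite).
data Form (n : ℕ) : Set where
  var  : ℕ → Form n
  ~_   : Form n → Form n
  _∧'_ : Form n → Form n → Form n
  K    : Fin n → Form n → Form n
  [_]_ : Form n → Form n → Form n
  U    : Fin n → Form n → Form n

infixr 6 _∧'_
infix 7 ~_
infixr 7 [_]_

module _ {n : ℕ} where

  infixr 4 _⇒_
  infix 3 _⇔'_

  _⇒_ : Form n → Form n → Form n
  φ ⇒ ψ = ~ (φ ∧' ~ ψ)

  _⇔'_ : Form n → Form n → Form n
  φ ⇔' ψ = (φ ⇒ ψ) ∧' (ψ ⇒ φ)

  ⊥' : Form n
  ⊥' = var 0 ∧' ~ var 0

  data IsEL : Form n → Set where
    el-var : ∀ p → IsEL (var p)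
    el-neg : ∀ {φ} → IsEL φ → IsEL (~ φ)
    el-and : ∀ {φ ψ} → IsEL φ → IsEL ψ → IsEL (φ ∧' ψ)
    el-K   : ∀ {i φ} → IsEL φ → IsEL (K i φ)

  -- Propositional tautologies: formulas true under every boolean valuation of
  -- their propositionally-atomic subformulas (variables, K_i-, [·]- and U_i-formulas).
  evalB : (Form n → Bool) → Form n → Bool
  evalB v (var p)   = v (var p)
  evalB v (~ φ)     = not (evalB v φ)
  evalB v (φ ∧' ψ)  = evalB v φ ∧ evalB v ψ
  evalB v (K i φ)   = v (K i φ)
  evalB v ([ χ ] φ) = v ([ χ ] φ)
  evalB v (U i φ)   = v (U i φ)

  Tautology : Form n → Set
  Tautology φ = ∀ (v : Form n → Bool) → evalB v φ ≡ true

  -- Admissible forms η(♯) ::= ♯ | φ → η(♯) | K_i η(♯) | [φ] η(♯)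
  data Eta : Set where
    hole  : Eta
    impη  : Form n → Eta → Eta
    Kη    : Fin n → Eta → Eta
    boxη  : Form n → Eta → Eta

  fill : Eta → Form n → Form n
  fill hole         χ = χ
  fill (impη φ η)   χ = φ ⇒ fill η χ
  fill (Kη i η)     χ = K i (fill η χ)
  fill (boxη φ η)   χ = [ φ ] fill η χ

  data Thm : Form n → Set where
    ax-taut  : ∀ {φ} → Tautology φ → Thm φ
    ax-KK    : ∀ {i φ ψ} → Thm (K i (φ ⇒ ψ) ⇒ (K i φ ⇒ K i ψ))
    ax-K□    : ∀ {χ φ ψ} → Thm ([ χ ] (φ ⇒ ψ) ⇒ ([ χ ] φ ⇒ [ χ ] ψ))
    ax-T     : ∀ {i φ} → Thm (K i φ ⇒ φ)
    ax-atom  : ∀ {ψ p} → Thm ([ ψ ] var p ⇔' (ψ ⇒ var p))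
    ax-neg   : ∀ {ψ φ} → Thm ([ ψ ] (~ φ) ⇔' (ψ ⇒ ~ ([ ψ ] φ)))
    ax-and   : ∀ {ψ φ χ} → Thm ([ ψ ] (φ ∧' χ) ⇔' ([ ψ ] φ ∧' [ ψ ] χ))
    ax-Kann  : ∀ {ψ i φ} → Thm ([ ψ ] K i φ ⇔' (ψ ⇒ K i ([ ψ ] φ)))
    ax-comp  : ∀ {ψ χ φ} → Thm ([ ψ ] [ χ ] φ ⇔' [ ψ ∧' [ ψ ] χ ] φ)
    ax-U     : ∀ {i φ ψ} → IsEL ψ → Thm (U i φ ⇒ (φ ∧' [ ψ ] (~ K i φ)))
    r-MP     : ∀ {φ ψ} → Thm (φ ⇒ ψ) → Thm φ → Thm ψ
    r-NecK   : ∀ {i φ} → Thm φ → Thm (K i φ)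
    r-Nec□   : ∀ {χ φ} → Thm φ → Thm ([ χ ] φ)
    r-RU     : ∀ (η : Eta) (φ : Form n) (i : Fin n) →
               (∀ ψ → IsEL ψ → Thm (fill η (φ ∧' [ ψ ] (~ K i φ)))) →
               Thm (fill η (U i φ))

  IsTheory : Pred (Form n) 0ℓ → Set
  IsTheory s =
      (∀ φ → Thm φ → s φ)
    × (∀ φ ψ → s (φ ⇒ ψ) → s φ → s ψ)
    × (∀ (η : Eta) (φ : Form n) (i : Fin n) →
         (∀ ψ → IsEL ψ → s (fill η (φ ∧' [ ψ ] (~ K i φ)))) →
         s (fill η (U i φ)))

  Consistent : Pred (Form n) 0ℓ → Set
  Consistent s = ¬ s ⊥'

  _+F_ : Pred (Form n) 0ℓ → Form n → Pred (Form n) 0ℓ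
  (s +F φ) ψ = s (φ ⇒ ψ)

{-# OPTIONS --safe #-}
module Submission where

open import Defs
open import Data.Nat using (ℕ)
open import Data.Bool using (true; false)
open import Data.Product using (_×_; _,_)
open import Function.Bundles using (_⇔_; mk⇔)
open import Relation.Nullary using (¬_)
open import Relation.Unary using (Pred)
open import Relation.Binary.PropositionalEquality using (refl)
open import Level using (0ℓ)

module _ {n : ℕ} where

  ⇒-weaken : (φ ψ : Form n) → Tautology (ψ ⇒ (φ ⇒ ψ))
  ⇒-weaken φ ψ v with evalB v φ | evalB v ψ
  ... | true  | true  = refl
  ... | true  | false = refl
  ... | false | true  = refl
  ... | false | false = refl

  ⇒-distrib : (φ ψ χ : Form n) → Tautology ((φ ⇒ (ψ ⇒ χ)) ⇒ ((φ ⇒ ψ) ⇒ (φ ⇒ χ)))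
  ⇒-distrib φ ψ χ v with evalB v φ | evalB v ψ | evalB v χ
  ... | true  | true  | true  = refl
  ... | true  | true  | false = refl
  ... | true  | false | _     = refl
  ... | false | _     | _     = refl

  ⇒-refl : (φ : Form n) → Tautology (φ ⇒ φ)
  ⇒-refl φ v with evalB v φ
  ... | true  = refl
  ... | false = refl

  ¬⇒⇒⊥ : (φ : Form n) → Tautology (~ φ ⇒ (φ ⇒ ⊥'))
  ¬⇒⇒⊥ φ v with evalB v φ | v (var 0)
  ... | true  | true  = refl
  ... | true  | false = refl
  ... | false | _     = refl

  ⇒⊥⇒¬ : (φ : Form n) → Tautology ((φ ⇒ ⊥') ⇒ ~ φ)
  ⇒⊥⇒¬ φ v with evalB v φ | v (var 0)
  ... | true  | true  = refl
  ... | true  | false = refl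
  ... | false | _     = refl

module _ {n : ℕ} {s : Pred (Form n) 0ℓ} (theory : IsTheory s) where

  private
    thm∈ : ∀ {φ} → Thm φ → s φ
    thm∈ {φ} = let (thm , _ , _) = theory in thm φ

    mp∈ : ∀ {φ ψ} → s (φ ⇒ ψ) → s φ → s ψ
    mp∈ {φ} {ψ} = let (_ , mp , _) = theory in mp φ ψ

  theory-tautMP : ∀ {φ ψ} → Tautology (φ ⇒ ψ) → s φ → s ψ
  theory-tautMP t = mp∈ (thm∈ (ax-taut t))

  +F-isTheory : ∀ φ → IsTheory (s +F φ)
  +F-isTheory φ =
      (λ ψ ⊢ψ → theory-tautMP (⇒-weaken φ ψ) (thm∈ ⊢ψ))
    , (λ ψ χ φ⇒ψ⇒χ φ⇒ψ → mp∈ (theory-tautMP (⇒-distrib φ ψ χ) φ⇒ψ⇒χ) φ⇒ψ)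
    -- RU for s + φ is RU for s at the admissible form φ → η(♯).
    , (λ η ψ i → let (_ , _ , ru) = theory in ru (impη φ η) ψ i)

  ⊆-+F : ∀ φ ψ → s ψ → (s +F φ) ψ
  ⊆-+F φ ψ = theory-tautMP (⇒-weaken φ ψ)

  ∈-+F : ∀ φ → (s +F φ) φ
  ∈-+F φ = thm∈ (ax-taut (⇒-refl φ))

  +F-consistent⇔ : ∀ φ → Consistent (s +F φ) ⇔ (¬ s (~ φ))
  +F-consistent⇔ φ = mk⇔
    (λ con ¬φ∈s → con (theory-tautMP (¬⇒⇒⊥ φ) ¬φ∈s))
    (λ ¬φ∉s φ⇒⊥∈s → ¬φ∉s (theory-tautMP (⇒⊥⇒¬ φ) φ⇒⊥∈s))

mainTheorem17 : ∀ {n : ℕ} (s : Pred (Form n) 0ℓ) (φ : Form n) → IsTheory s →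
    (IsTheory (s +F φ) × (∀ ψ → s ψ → (s +F φ) ψ) × (s +F φ) φ)
    × (Consistent (s +F φ) ⇔ (¬ s (~ φ)))
mainTheorem17 s φ theory =
    (+F-isTheory theory φ , ⊆-+F theory φ , ∈-+F theory φ)
  , +F-consistent⇔ theory φ
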